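{- For all integers $m\ge1$ and $n\ge1$, with $s=m+n$, $$\binom{s}{n}=(3+2s)\sum_{i=0}^{n}(-1)^i\,\frac{\binom{2+s+n}{i}\binom{s+1}{n-i}}{(i+1)\binom{3+2s+n}{i+1}}.$$ -}

module Defs where

open import Data.Nat using (ℕ; zero; suc)
open import Data.Integer using (ℤ)
open import Data.Rational using (ℚ; 0ℚ; _/_; _+_)

-- p // d : the rational p/d for a natural denominator d.
-- Convention for d = 0 (never used in the theorem, where all
-- denominators are positive): 0.
_//_ : ℤ → ℕ → ℚ
p // zero = 0ℚ
p // suc k = p / suc k

infixl 7 _//_

sumTo : (ℕ → ℚ) → ℕ → ℚ
sumTo f zero = f zero
sumTo f (suc n) = sumTo f n + f (suc n)

-- Absorption, (i+1)·C(3+2s+n, i+1) = (3+2s+n)·C(2+2s+n, i), together with the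
-- trinomial revision C(M−s, i)·C(M, s) = C(M−i, s)·C(M, i) for M = 2+2s+n, brings
-- the i-th summand to the common denominator D s n = (3+2s+n)·C(2+2s+n, s) with
-- numerator (−1)^i·G s (n−i), where G s j = C(s+1, j)·C(2+2s+j, s).  The
-- alternating sum W n = Σᵢ (−1)^i·G s (n−i) satisfies W (n+1) = G s (n+1) − W n,
-- while R n = D s n·C(s, n) satisfies R (n+1) + R n = (3+2s)·G s (n+1), which
-- reduces to (n+1)·C(s, n+1) + n·C(s, n) = s·C(s, n).  As (3+2s)·G s 0 = R 0,
-- induction gives (3+2s)·W n = R n, so the right-hand side is R n / D s n = C(s, n).
-- The identity thus holds for all s and n.

module Submission where

open import Defs
open import Data.Nat using (ℕ; _≤_; _∸_)
open import Data.Nat.Combinatorics using (_C_)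
open import Data.Integer using (+_; -1ℤ)
open import Data.Rational using (ℚ)
open import Relation.Binary.PropositionalEquality using (_≡_)
import Data.Nat as N
import Data.Integer as Z
import Data.Rational as Q

module Binomial where

  open import Data.Nat.Base
  open import Data.Nat.Properties
  open import Data.Nat.Combinatorics
  open import Data.Nat.DivMod using (m/n*n≡m)
  open import Data.Nat.Tactic.RingSolver using (solve-∀)
  open import Data.Product using (_,_)
  open import Data.Sum using (inj₁; inj₂)
  open import Relation.Binary.PropositionalEquality
  open ≡-Reasoning

  nC0≡1 : ∀ n → n C 0 ≡ 1
  nC0≡1 n = trans (nCk≡nC[n∸k] {n = n} z≤n) (nCn≡1 n)

  nCk*[k!*[n∸k]!]≡n! : ∀ {n k} → k ≤ n → (n C k) * (k ! * (n ∸ k) !) ≡ n !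
  nCk*[k!*[n∸k]!]≡n! {n} {k} k≤n =
    trans (cong (_* (k ! * (n ∸ k) !)) (nCk≡n!/k![n-k]! k≤n)) (m/n*n≡m (k![n∸k]!∣n! k≤n))
    where instance _ = k !* (n ∸ k) !≢0

  [m+n]Cm*[m!*n!]≡[m+n]! : ∀ m n → ((m + n) C m) * (m ! * n !) ≡ (m + n) !
  [m+n]Cm*[m!*n!]≡[m+n]! m n =
    subst (λ k → ((m + n) C m) * (m ! * k !) ≡ (m + n) !)
          (m+n∸m≡n m n) (nCk*[k!*[n∸k]!]≡n! (m≤m+n m n))

  [m+n]Cm≡[m+n]Cn : ∀ m n → (m + n) C m ≡ (m + n) C n
  [m+n]Cm≡[m+n]Cn m n =
    trans (nCk≡nC[n∸k] (m≤m+n m n)) (cong ((m + n) C_) (m+n∸m≡n m n))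

  [m+n]Cn*[m!*n!]≡[m+n]! : ∀ m n → ((m + n) C n) * (m ! * n !) ≡ (m + n) !
  [m+n]Cn*[m!*n!]≡[m+n]! m n =
    trans (cong (_* (m ! * n !)) (sym ([m+n]Cm≡[m+n]Cn m n))) ([m+n]Cm*[m!*n!]≡[m+n]! m n)

  k≤n⇒nCk≢0 : ∀ {n k} → k ≤ n → NonZero (n C k)
  k≤n⇒nCk≢0 {n} {k} k≤n =
    m*n≢0⇒m≢0 (n C k) {{subst NonZero (sym (nCk*[k!*[n∸k]!]≡n! k≤n)) (n !≢0)}}

  [k+1]*[n+1]C[k+1]≡[n+1]*nCk : ∀ n k → suc k * (suc n C suc k) ≡ suc n * (n C k)
  [k+1]*[n+1]C[k+1]≡[n+1]*nCk n k with ≤-<-connex k n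
  ... | inj₂ n<k rewrite k>n⇒nCk≡0 n<k | k>n⇒nCk≡0 (s<s n<k) =
    trans (*-zeroʳ (suc k)) (sym (*-zeroʳ (suc n)))
  ... | inj₁ k≤n with m≤n⇒∃[o]m+o≡n k≤n
  ... | r , refl = *-cancelʳ-≡ _ _ (k ! * r !) {{k !* r !≢0}} (begin
    suc k * ((suc k + r) C suc k) * (k ! * r !)
      ≡⟨ rearrange (suc k) ((suc k + r) C suc k) (k !) (r !) ⟩
    ((suc k + r) C suc k) * (suc k ! * r !)
      ≡⟨ [m+n]Cm*[m!*n!]≡[m+n]! (suc k) r ⟩
    suc (k + r) * (k + r) !
      ≡⟨ cong (suc (k + r) *_) ([m+n]Cm*[m!*n!]≡[m+n]! k r) ⟨
    suc (k + r) * (((k + r) C k) * (k ! * r !))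
      ≡⟨ *-assoc (suc (k + r)) ((k + r) C k) (k ! * r !) ⟨
    suc (k + r) * ((k + r) C k) * (k ! * r !) ∎)
    where
    rearrange : ∀ a c f g → a * c * (f * g) ≡ c * (a * f * g)
    rearrange = solve-∀

  [k+1]*nC[k+1]+k*nCk≡n*nCk : ∀ n k → suc k * (n C suc k) + k * (n C k) ≡ n * (n C k)
  [k+1]*nC[k+1]+k*nCk≡n*nCk zero zero = refl
  [k+1]*nC[k+1]+k*nCk≡n*nCk zero (suc k)
    rewrite k>n⇒nCk≡0 (z<s {suc k}) | k>n⇒nCk≡0 (z<s {k}) | *-zeroʳ k = refl
  [k+1]*nC[k+1]+k*nCk≡n*nCk (suc n) zero
    rewrite nC1≡n (suc n) | nC0≡1 (suc n) = trans (+-identityʳ _) (*-comm 1 (suc n))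
  [k+1]*nC[k+1]+k*nCk≡n*nCk (suc n) (suc k) = begin
    suc (suc k) * (suc n C suc (suc k)) + suc k * (suc n C suc k)
      ≡⟨ cong₂ _+_ ([k+1]*[n+1]C[k+1]≡[n+1]*nCk n (suc k)) ([k+1]*[n+1]C[k+1]≡[n+1]*nCk n k) ⟩
    suc n * (n C suc k) + suc n * (n C k)  ≡⟨ *-distribˡ-+ (suc n) (n C suc k) (n C k) ⟨
    suc n * ((n C suc k) + (n C k))        ≡⟨ cong (suc n *_) (+-comm _ (n C k)) ⟩
    suc n * ((n C k) + (n C suc k))        ≡⟨ cong (suc n *_) (nCk+nC[k+1]≡[n+1]C[k+1] n k) ⟩
    suc n * (suc n C suc k)                ∎

  trinomial-revision : ∀ i r s →
    ((i + r) C i) * ((i + r + s) C s) ≡ ((r + s) C s) * ((i + r + s) C i)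
  trinomial-revision i r s =
    *-cancelʳ-≡ _ _ (i ! * r ! * s !) {{m*n≢0 _ _ {{i !* r !≢0}} {{s !≢0}}}} (begin
    ((i + r) C i) * ((i + r + s) C s) * (i ! * r ! * s !)
      ≡⟨ regroupˡ ((i + r) C i) ((i + r + s) C s) (i !) (r !) (s !) ⟩
    ((i + r + s) C s) * (((i + r) C i) * (i ! * r !) * s !)
      ≡⟨ cong (λ x → ((i + r + s) C s) * (x * s !)) ([m+n]Cm*[m!*n!]≡[m+n]! i r) ⟩
    ((i + r + s) C s) * ((i + r) ! * s !)
      ≡⟨ [m+n]Cn*[m!*n!]≡[m+n]! (i + r) s ⟩
    (i + r + s) !
      ≡⟨ cong _! (+-assoc i r s) ⟩
    (i + (r + s)) !
      ≡⟨ [m+n]Cm*[m!*n!]≡[m+n]! i (r + s) ⟨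
    ((i + (r + s)) C i) * (i ! * (r + s) !)
      ≡⟨ cong₂ (λ x y → (x C i) * (i ! * y))
               (sym (+-assoc i r s)) (sym ([m+n]Cn*[m!*n!]≡[m+n]! r s)) ⟩
    ((i + r + s) C i) * (i ! * (((r + s) C s) * (r ! * s !)))
      ≡⟨ regroupʳ ((r + s) C s) ((i + r + s) C i) (i !) (r !) (s !) ⟩
    ((r + s) C s) * ((i + r + s) C i) * (i ! * r ! * s !) ∎)
    where
    regroupˡ : ∀ a b x y z → a * b * (x * y * z) ≡ b * (a * (x * y) * z)
    regroupˡ = solve-∀
    regroupʳ : ∀ a b x y z → b * (x * (a * (y * z))) ≡ a * b * (x * y * z)
    regroupʳ = solve-∀

  [m+n+1]*[m+n]Cm≡[n+1]*[m+n+1]Cm : ∀ m n → suc (m + n) * ((m + n) C m) ≡ suc n * (suc (m + n) C m)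
  [m+n+1]*[m+n]Cm≡[n+1]*[m+n+1]Cm m n = begin
    suc (m + n) * ((m + n) C m)    ≡⟨ cong (suc (m + n) *_) ([m+n]Cm≡[m+n]Cn m n) ⟩
    suc (m + n) * ((m + n) C n)    ≡⟨ [k+1]*[n+1]C[k+1]≡[n+1]*nCk (m + n) n ⟨
    suc n * (suc (m + n) C suc n)  ≡⟨ cong (suc n *_) [m+n+1]C[n+1]≡[m+n+1]Cm ⟩
    suc n * (suc (m + n) C m)      ∎
    where
    [m+n+1]C[n+1]≡[m+n+1]Cm : suc (m + n) C suc n ≡ suc (m + n) C m
    [m+n+1]C[n+1]≡[m+n+1]Cm =
      subst (λ k → k C suc n ≡ k C m) (+-suc m n) (sym ([m+n]Cm≡[m+n]Cn m (suc n)))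

module IntegerSums where

  open import Data.Nat.Base using (zero; suc)
  open import Data.Integer.Base using (ℤ; _+_; _-_; _*_; _^_; 1ℤ; -1ℤ)
  open import Data.Integer.Properties using (+-assoc; *-assoc; *-identityˡ; *-distribˡ-+; -1*i≡-i)
  open import Data.Integer.Tactic.RingSolver using (solve)
  open import Data.List.Base using (_∷_; [])
  open import Relation.Binary.PropositionalEquality
  open ≡-Reasoning

  sumToℤ : (ℕ → ℤ) → ℕ → ℤ
  sumToℤ f zero    = f zero
  sumToℤ f (suc n) = sumToℤ f n + f (suc n)

  sumToℤ-cong : ∀ {f g} n → (∀ i → f i ≡ g i) → sumToℤ f n ≡ sumToℤ g n
  sumToℤ-cong zero    f≗g = f≗g zero
  sumToℤ-cong (suc n) f≗g = cong₂ _+_ (sumToℤ-cong n f≗g) (f≗g (suc n))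

  sumToℤ-suc : ∀ f n → sumToℤ f (suc n) ≡ f 0 + sumToℤ (λ i → f (suc i)) n
  sumToℤ-suc f zero    = refl
  sumToℤ-suc f (suc n) = trans (cong (_+ f (suc (suc n))) (sumToℤ-suc f n))
                               (+-assoc (f 0) (sumToℤ (λ i → f (suc i)) n) (f (suc (suc n))))

  sumToℤ-*ˡ : ∀ a f n → sumToℤ (λ i → a * f i) n ≡ a * sumToℤ f n
  sumToℤ-*ˡ a f zero    = refl
  sumToℤ-*ˡ a f (suc n) = trans (cong (_+ a * f (suc n)) (sumToℤ-*ˡ a f n))
                                (sym (*-distribˡ-+ a (sumToℤ f n) (f (suc n))))

  alternating : (ℕ → ℤ) → ℕ → ℤ
  alternating g n = sumToℤ (λ i → -1ℤ ^ i * g (n ∸ i)) n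

  alternating-suc : ∀ g n → alternating g (suc n) ≡ g (suc n) - alternating g n
  alternating-suc g n = begin
    alternating g (suc n)
      ≡⟨ sumToℤ-suc (λ i → -1ℤ ^ i * g (suc n ∸ i)) n ⟩
    1ℤ * g (suc n) + sumToℤ (λ i → -1ℤ ^ suc i * g (n ∸ i)) n
      ≡⟨ cong₂ _+_ (*-identityˡ (g (suc n)))
                   (sumToℤ-cong n (λ i → *-assoc -1ℤ (-1ℤ ^ i) (g (n ∸ i)))) ⟩
    g (suc n) + sumToℤ (λ i → -1ℤ * (-1ℤ ^ i * g (n ∸ i))) n
      ≡⟨ cong (λ x → g (suc n) + x) (sumToℤ-*ˡ -1ℤ (λ i → -1ℤ ^ i * g (n ∸ i)) n) ⟩
    g (suc n) + -1ℤ * alternating g n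
      ≡⟨ cong (λ x → g (suc n) + x) (-1*i≡-i (alternating g n)) ⟩
    g (suc n) - alternating g n ∎

  alternating-telescope : ∀ (c : ℤ) (g r : ℕ → ℤ) →
                          c * g 0 ≡ r 0 → (∀ n → r (suc n) + r n ≡ c * g (suc n)) →
                          ∀ n → c * alternating g n ≡ r n
  alternating-telescope c g r base step zero = trans (cong (c *_) (*-identityˡ (g 0))) base
  alternating-telescope c g r base step (suc n) = begin
    c * alternating g (suc n)               ≡⟨ cong (c *_) (alternating-suc g n) ⟩
    c * (g (suc n) - alternating g n)       ≡⟨ distrib c (g (suc n)) (alternating g n) ⟩
    c * g (suc n) - c * alternating g n     ≡⟨ cong₂ _-_ (sym (step n)) induction-hypothesis ⟩
    r (suc n) + r n - r n                   ≡⟨ cancel (r (suc n)) (r n) ⟩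
    r (suc n)                               ∎
    where
    induction-hypothesis : c * alternating g n ≡ r n
    induction-hypothesis = alternating-telescope c g r base step n
    distrib : ∀ a b w → a * (b - w) ≡ a * b - a * w
    distrib a b w = solve (a ∷ b ∷ w ∷ [])
    cancel : ∀ a b → a + b - b ≡ a
    cancel a b = solve (a ∷ b ∷ [])

module Fractions where

  open import Data.Nat.Base using (zero; suc; NonZero; z≤n)
  open import Data.Nat.Properties using (m≤n⇒m≤1+n; ≤-refl)
  open import Data.Integer.Base using (+_; _+_; _*_)
  open import Data.Integer.Properties using (*-assoc; *-identityʳ; pos-*)
  open import Data.Integer.Tactic.RingSolver using (solve-∀)
  import Data.Nat.Base as ℕ
  import Data.Nat.Properties as ℕ
  open import Data.Rational.Base as ℚ using (ℚ; toℚᵘ)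
  open import Data.Rational.Properties
    using (toℚᵘ-injective; toℚᵘ-fromℚᵘ; toℚᵘ-homo-+; toℚᵘ-homo-*; *-zeroʳ)
  open import Data.Rational.Unnormalised.Base using (mkℚᵘ; *≡*; _≃_)
  open import Data.Rational.Unnormalised.Properties using (≃-trans; ≃-sym; +-cong; *-cong)
  open import Relation.Binary.PropositionalEquality
  open ≡-Reasoning

  toℚᵘ-// : ∀ p k → toℚᵘ (p // suc k) ≃ mkℚᵘ p k
  toℚᵘ-// p k = toℚᵘ-fromℚᵘ (mkℚᵘ p k)

  //-cong-cross : ∀ p q d e .{{_ : NonZero d}} .{{_ : NonZero e}} →
                  p * + e ≡ q * + d → p // d ≡ q // e
  //-cong-cross p q (suc d) (suc e) eq = toℚᵘ-injective
    (≃-trans (toℚᵘ-// p d) (≃-trans (*≡* eq) (≃-sym (toℚᵘ-// q e))))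

  p//d+q//d≡[p+q]//d : ∀ p q d → p // d ℚ.+ q // d ≡ (p + q) // d
  p//d+q//d≡[p+q]//d p q zero    = refl
  p//d+q//d≡[p+q]//d p q (suc d) = toℚᵘ-injective
    (≃-trans (toℚᵘ-homo-+ (p // suc d) (q // suc d))
    (≃-trans (+-cong (toℚᵘ-// p d) (toℚᵘ-// q d))
    (≃-trans (*≡* (common-denominator p q (+ suc d))) (≃-sym (toℚᵘ-// (p + q) d)))))
    where
    common-denominator : ∀ p q s → (p * s + q * s) * s ≡ (p + q) * (s * s)
    common-denominator = solve-∀

  p//1*q//d≡[p*q]//d : ∀ p q d → (p // 1) ℚ.* (q // d) ≡ (p * q) // d
  p//1*q//d≡[p*q]//d p q zero    = *-zeroʳ (p // 1)
  p//1*q//d≡[p*q]//d p q (suc d) = toℚᵘ-injective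
    (≃-trans (toℚᵘ-homo-* (p // 1) (q // suc d))
    (≃-trans (*-cong (toℚᵘ-// p 0) (toℚᵘ-// q d))
    (≃-trans (*≡* (unit-denominator p q (+ suc d))) (≃-sym (toℚᵘ-// (p * q) d)))))
    where
    unit-denominator : ∀ p q s → (p * q) * s ≡ (p * q) * (+ 1 * s)
    unit-denominator = solve-∀

  signed-//-cong-cross : ∀ σ a b c e .{{_ : NonZero b}} .{{_ : NonZero e}} →
                         a ℕ.* e ≡ c ℕ.* b → (σ * + a) // b ≡ (σ * + c) // e
  signed-//-cong-cross σ a b c e ae≡cb = //-cong-cross (σ * + a) (σ * + c) b e (begin
    σ * + a * + e      ≡⟨ *-assoc σ (+ a) (+ e) ⟩
    σ * (+ a * + e)    ≡⟨ cong (σ *_) (pos-* a e) ⟨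
    σ * + (a ℕ.* e)    ≡⟨ cong (λ k → σ * + k) ae≡cb ⟩
    σ * + (c ℕ.* b)    ≡⟨ cong (σ *_) (pos-* c b) ⟩
    σ * (+ c * + b)    ≡⟨ *-assoc σ (+ c) (+ b) ⟨
    σ * + c * + b      ∎)

  [d*x]//d≡x//1 : ∀ d x .{{_ : NonZero d}} → + (d ℕ.* x) // d ≡ + x // 1
  [d*x]//d≡x//1 d x = //-cong-cross (+ (d ℕ.* x)) (+ x) d 1
    (trans (*-identityʳ (+ (d ℕ.* x))) (trans (cong +_ (ℕ.*-comm d x)) (pos-* x d)))

  open IntegerSums using (sumToℤ)

  sumTo-cong-≤ : ∀ {f g : ℕ → ℚ} n → (∀ {i} → i ≤ n → f i ≡ g i) → sumTo f n ≡ sumTo g n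
  sumTo-cong-≤ zero    f≗g = f≗g z≤n
  sumTo-cong-≤ (suc n) f≗g =
    cong₂ ℚ._+_ (sumTo-cong-≤ n (λ i≤n → f≗g (m≤n⇒m≤1+n i≤n))) (f≗g ≤-refl)

  sumTo-// : ∀ g d n → sumTo (λ i → g i // d) n ≡ sumToℤ g n // d
  sumTo-// g d zero    = refl
  sumTo-// g d (suc n) = trans (cong (ℚ._+ g (suc n) // d) (sumTo-// g d n))
                               (p//d+q//d≡[p+q]//d (sumToℤ g n) (g (suc n)) d)

open Binomial
open IntegerSums
open Fractions

open import Data.Nat.Base using (suc; _+_; _*_; NonZero)
open import Data.Nat.Properties
  using (+-comm; +-suc; *-assoc; m*n≢0; m≤m+n; m≤n+m; m+n∸m≡n; m≤n⇒∃[o]m+o≡n;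
         *-commutativeSemigroup)
open import Data.Nat.Combinatorics using (nCk+nC[k+1]≡[n+1]C[k+1])
open import Data.Nat.Tactic.RingSolver using (solve)
import Data.Integer.Properties as ℤ
open import Data.List.Base using (_∷_; [])
open import Data.Product using (_,_)
open import Relation.Binary.PropositionalEquality
  using (refl; sym; trans; cong; cong₂; subst; module ≡-Reasoning)
open import Algebra.Properties.CommutativeSemigroup *-commutativeSemigroup
  using (x∙yz≈y∙xz; xy∙z≈y∙xz)
open ≡-Reasoning

summand : ℕ → ℕ → ℕ → ℚ
summand s n i = ((-1ℤ Z.^ i) Z.* (+ (((2 N.+ s N.+ n) C i) N.* ((s N.+ 1) C (n ∸ i)))))
                  // ((i N.+ 1) N.* ((3 N.+ 2 N.* s N.+ n) C (i N.+ 1)))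

D : ℕ → ℕ → ℕ
D s n = (3 + 2 * s + n) * ((2 + 2 * s + n) C s)

G : ℕ → ℕ → ℕ
G s j = ((s + 1) C j) * ((2 + 2 * s + j) C s)

D≢0 : ∀ s n → NonZero (D s n)
D≢0 s n = m*n≢0 (3 + 2 * s + n) _ {{_}} {{k≤n⇒nCk≢0 s≤2+2s+n}}
  where
  s≤2+2s+n : s ≤ 2 + 2 * s + n
  s≤2+2s+n = subst (s ≤_) rearranged (m≤n+m s (2 + s + n))
    where
    rearranged : 2 + s + n + s ≡ 2 + 2 * s + n
    rearranged = solve (s ∷ n ∷ [])

summand-rescaling : ∀ s i u →
  ((2 + s + (i + u)) C i) * D s (i + u) ≡
  ((2 + 2 * s + u) C s) * ((i + 1) * ((3 + 2 * s + (i + u)) C (i + 1)))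
summand-rescaling s i u = begin
  ((2 + s + (i + u)) C i) * (suc M * (M C s))
    ≡⟨ x∙yz≈y∙xz ((2 + s + (i + u)) C i) (suc M) (M C s) ⟩
  suc M * (((2 + s + (i + u)) C i) * (M C s))
    ≡⟨ cong₂ (λ a b → suc M * ((a C i) * (b C s))) lower-row whole ⟩
  suc M * (((i + r) C i) * ((i + r + s) C s))
    ≡⟨ cong (suc M *_) (trinomial-revision i r s) ⟩
  suc M * (((r + s) C s) * ((i + r + s) C i))
    ≡⟨ cong₂ (λ a b → suc M * ((a C s) * (b C i))) upper-row (sym whole) ⟩
  suc M * (((2 + 2 * s + u) C s) * (M C i))
    ≡⟨ x∙yz≈y∙xz (suc M) ((2 + 2 * s + u) C s) (M C i) ⟩
  ((2 + 2 * s + u) C s) * (suc M * (M C i))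
    ≡⟨ cong (((2 + 2 * s + u) C s) *_) ([k+1]*[n+1]C[k+1]≡[n+1]*nCk M i) ⟨
  ((2 + 2 * s + u) C s) * (suc i * (suc M C suc i))
    ≡⟨ cong (λ k → ((2 + 2 * s + u) C s) * (k * (suc M C k))) (+-comm 1 i) ⟩
  ((2 + 2 * s + u) C s) * ((i + 1) * ((3 + 2 * s + (i + u)) C (i + 1))) ∎
  where
  M : ℕ
  M = 2 + 2 * s + (i + u)
  r : ℕ
  r = 2 + s + u
  lower-row : 2 + s + (i + u) ≡ i + (2 + s + u)
  lower-row = solve (s ∷ i ∷ u ∷ [])
  whole : 2 + 2 * s + (i + u) ≡ i + (2 + s + u) + s
  whole = solve (s ∷ i ∷ u ∷ [])
  upper-row : 2 + s + u + s ≡ 2 + 2 * s + u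
  upper-row = solve (s ∷ u ∷ [])

summand≡ : ∀ s n {i} → i ≤ n → summand s n i ≡ ((-1ℤ Z.^ i) Z.* + G s (n ∸ i)) // D s n
summand≡ s n {i} i≤n with m≤n⇒∃[o]m+o≡n i≤n
... | u , refl rewrite m+n∸m≡n i u =
  signed-//-cong-cross (-1ℤ Z.^ i) (X * Y) d (Y * Z) (D s (i + u)) {{d≢0}} {{D≢0 s (i + u)}} (begin
    X * Y * D s (i + u)    ≡⟨ xy∙z≈y∙xz X Y (D s (i + u)) ⟩
    Y * (X * D s (i + u))  ≡⟨ cong (Y *_) (summand-rescaling s i u) ⟩
    Y * (Z * d)            ≡⟨ *-assoc Y Z d ⟨
    Y * Z * d              ∎)
  where
  X : ℕ
  X = (2 + s + (i + u)) C i
  Y : ℕ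
  Y = (s + 1) C u
  Z : ℕ
  Z = (2 + 2 * s + u) C s
  d : ℕ
  d = (i + 1) * ((3 + 2 * s + (i + u)) C (i + 1))
  d≢0 : NonZero d
  d≢0 = m*n≢0 (i + 1) _ {{subst NonZero (+-comm 1 i) _}} {{k≤n⇒nCk≢0 i+1≤3+2s+n}}
    where
    i+1≤3+2s+n : i + 1 ≤ 3 + 2 * s + (i + u)
    i+1≤3+2s+n = subst (i + 1 ≤_) rearranged (m≤m+n (i + 1) (2 + 2 * s + u))
      where
      rearranged : i + 1 + (2 + 2 * s + u) ≡ 3 + 2 * s + (i + u)
      rearranged = solve (s ∷ i ∷ u ∷ [])

D≡[3+s+n]*[3+2s+n]Cs : ∀ s n → D s n ≡ (3 + s + n) * ((3 + 2 * s + n) C s)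
D≡[3+s+n]*[3+2s+n]Cs s n =
  subst (λ k → suc k * (k C s) ≡ (3 + s + n) * (suc k C s)) (sym rearranged)
        ([m+n+1]*[m+n]Cm≡[n+1]*[m+n+1]Cm s (2 + s + n))
  where
  rearranged : 2 + 2 * s + n ≡ s + (2 + s + n)
  rearranged = solve (s ∷ n ∷ [])

D-step : ∀ s n → D s (suc n) * (s C suc n) + D s n * (s C n) ≡ (3 + 2 * s) * G s (suc n)
D-step s n = begin
  D s (suc n) * a + D s n * b
    ≡⟨ cong₂ (λ x y → x * a + y * b) D-suc (D≡[3+s+n]*[3+2s+n]Cs s n) ⟩
  (4 + 2 * s + n) * E * a + (3 + s + n) * E * b
    ≡⟨ factor (4 + 2 * s + n) (3 + s + n) E a b ⟩
  ((4 + 2 * s + n) * a + (3 + s + n) * b) * E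
    ≡⟨ cong (_* E) (coefficients a b ([k+1]*nC[k+1]+k*nCk≡n*nCk s n)) ⟩
  (3 + 2 * s) * (b + a) * E
    ≡⟨ cong₂ (λ x y → (3 + 2 * s) * x * (y C s)) pascal (sym (+-suc (2 + 2 * s) n)) ⟩
  (3 + 2 * s) * ((s + 1) C suc n) * ((2 + 2 * s + suc n) C s)
    ≡⟨ *-assoc (3 + 2 * s) ((s + 1) C suc n) ((2 + 2 * s + suc n) C s) ⟩
  (3 + 2 * s) * G s (suc n) ∎
  where
  a : ℕ
  a = s C suc n
  b : ℕ
  b = s C n
  E : ℕ
  E = (3 + 2 * s + n) C s
  D-suc : D s (suc n) ≡ (4 + 2 * s + n) * E
  D-suc = cong₂ (λ x y → x * (y C s)) (+-suc (3 + 2 * s) n) (+-suc (2 + 2 * s) n)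
  pascal : b + a ≡ (s + 1) C suc n
  pascal = trans (nCk+nC[k+1]≡[n+1]C[k+1] s n) (cong (_C suc n) (+-comm 1 s))
  factor : ∀ x y e a b → x * e * a + y * e * b ≡ (x * a + y * b) * e
  factor x y e a b = solve (x ∷ y ∷ e ∷ a ∷ b ∷ [])
  coefficients : ∀ a b → suc n * a + n * b ≡ s * b →
                 (4 + 2 * s + n) * a + (3 + s + n) * b ≡ (3 + 2 * s) * (b + a)
  coefficients a b absorbed = begin
    (4 + 2 * s + n) * a + (3 + s + n) * b
      ≡⟨ solve (s ∷ n ∷ a ∷ b ∷ []) ⟩
    (suc n * a + n * b) + ((3 + 2 * s) * a + (3 + s) * b)
      ≡⟨ cong (_+ ((3 + 2 * s) * a + (3 + s) * b)) absorbed ⟩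
    s * b + ((3 + 2 * s) * a + (3 + s) * b)
      ≡⟨ solve (s ∷ a ∷ b ∷ []) ⟩
    (3 + 2 * s) * (b + a) ∎

alternating-G-closed-form : ∀ s n →
  + (3 + 2 * s) Z.* alternating (λ j → + G s j) n ≡ + (D s n * (s C n))
alternating-G-closed-form s =
  alternating-telescope (+ (3 + 2 * s)) (λ j → + G s j) (λ n → + (D s n * (s C n)))
    (trans (sym (ℤ.pos-* (3 + 2 * s) (G s 0))) (cong +_ base))
    step
  where
  step : ∀ n → + (D s (suc n) * (s C suc n)) Z.+ + (D s n * (s C n))
               ≡ + (3 + 2 * s) Z.* + G s (suc n)
  step n = trans (sym (ℤ.pos-+ (D s (suc n) * (s C suc n)) (D s n * (s C n))))
                 (trans (cong +_ (D-step s n)) (ℤ.pos-* (3 + 2 * s) (G s (suc n))))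
  base : (3 + 2 * s) * G s 0 ≡ D s 0 * (s C 0)
  base = begin
    (3 + 2 * s) * (((s + 1) C 0) * E₀) ≡⟨ cong (λ x → (3 + 2 * s) * (x * E₀)) (nC0≡1 (s + 1)) ⟩
    (3 + 2 * s) * (1 * E₀)             ≡⟨ units (3 + 2 * s) E₀ ⟩
    (3 + 2 * s + 0) * E₀ * 1           ≡⟨ cong (D s 0 *_) (nC0≡1 s) ⟨
    D s 0 * (s C 0)                    ∎
    where
    E₀ : ℕ
    E₀ = (2 + 2 * s + 0) C s
    units : ∀ x e → x * (1 * e) ≡ (x + 0) * e * 1
    units x e = solve (x ∷ e ∷ [])

sCn≡[3+2s]*alternating-sum : ∀ s n →
  (+ (s C n)) // 1 ≡ ((+ (3 N.+ 2 N.* s)) // 1) Q.* sumTo (summand s n) n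
sCn≡[3+2s]*alternating-sum s n = sym (begin
  (c // 1) Q.* sumTo (summand s n) n        ≡⟨ cong ((c // 1) Q.*_) (sumTo-cong-≤ n (summand≡ s n)) ⟩
  (c // 1) Q.* sumTo (λ i → h i // D s n) n ≡⟨ cong ((c // 1) Q.*_) (sumTo-// h (D s n) n) ⟩
  (c // 1) Q.* (sumToℤ h n // D s n)        ≡⟨ p//1*q//d≡[p*q]//d c (sumToℤ h n) (D s n) ⟩
  (c Z.* sumToℤ h n) // D s n               ≡⟨ cong (_// D s n) (alternating-G-closed-form s n) ⟩
  + (D s n * (s C n)) // D s n              ≡⟨ [d*x]//d≡x//1 (D s n) (s C n) {{D≢0 s n}} ⟩
  + (s C n) // 1                            ∎)
  where
  c : Z.ℤ
  c = + (3 + 2 * s)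
  h : ℕ → Z.ℤ
  h = λ i → (-1ℤ Z.^ i) Z.* + G s (n ∸ i)

theorem12 : (m n : ℕ) → 1 ≤ m → 1 ≤ n →
    let s = m N.+ n in
    (+ (s C n)) // 1 ≡
      ((+ (3 N.+ 2 N.* s)) // 1) Q.*
        sumTo (λ i → ((-1ℤ Z.^ i) Z.* (+ (((2 N.+ s N.+ n) C i) N.* ((s N.+ 1) C (n ∸ i)))))
                       // ((i N.+ 1) N.* ((3 N.+ 2 N.* s N.+ n) C (i N.+ 1)))) n
theorem12 m n _ _ = sCn≡[3+2s]*alternating-sum (m N.+ n) n
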